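{- Let $m \geq 3$ and $l_1\le\cdots\le l_m$ be natural numbers, $H = B(l_1,\ldots,l_m)$ and $G = H^2$. Then $G$ is equitably $(m+2)$-choosable.
   Context: $B(l_1,\ldots,l_m)$ denotes the graph with vertex set $\{u\}\cup\{v_{i,j}: i\in[m], j\in[l_i]\}$ where for each $i$ the vertices $u, v_{i,1},\ldots,v_{i,l_i}$ form a path in this order (a subdivision of $K_{1,m}$). $H^2$ is the square of $H$ (two vertices adjacent iff at distance at most 2 in $H$). A $k$-assignment $L$ assigns to each vertex a list of exactly $k$ colors; an equitable $L$-coloring of $G$ is a proper coloring $f$ with $f(v)\in L(v)$ using each color at most $\lceil |V(G)|/k\rceil$ times; $G$ is equitably $k$-choosable if it has an equitable $L$-coloring for every $k$-assignment $L$. -}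

module Defs where

open import Data.Nat using (ℕ; zero; suc; _+_; _≤_; _/_)
open import Data.Nat.Properties using (_≟_)
open import Data.Fin using (Fin) renaming (_≤_ to _≤ᶠ_)
open import Data.List using (List; []; _∷_; length; filter; map; concatMap; allFin)
open import Data.List.Membership.Propositional using (_∈_)
open import Data.List.Relation.Unary.Unique.Propositional using (Unique)
open import Data.Product using (Σ; _×_; ∃)
open import Data.Sum using (_⊎_)
open import Relation.Binary.PropositionalEquality using (_≡_; _≢_)

-- ceiling division ⌈ n / k ⌉ (junk value 0 for k = 0, never used)
ceilDiv : ℕ → ℕ → ℕ
ceilDiv n zero    = 0
ceilDiv n (suc k) = (n + k) / suc k

-- Generic notions for a finite graph given by a vertex type V,
-- a list enumerating every vertex exactly once, and an adjacency relation.

colourCount : {V : Set} → List V → (V → ℕ) → ℕ → ℕ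
colourCount vs f c = length (filter (λ v → f v ≟ c) vs)

IsAssignment : {V : Set} → ℕ → (V → List ℕ) → Set
IsAssignment k L = ∀ v → length (L v) ≡ k × Unique (L v)

IsEquitableLColouring : {V : Set} → List V → (V → V → Set) → ℕ →
                        (V → List ℕ) → (V → ℕ) → Set
IsEquitableLColouring vs Adj k L f =
  (∀ v → f v ∈ L v) ×
  (∀ u v → Adj u v → f u ≢ f v) ×
  (∀ c → colourCount vs f c ≤ ceilDiv (length vs) k)

EquitablyChoosable : {V : Set} → List V → (V → V → Set) → ℕ → Set
EquitablyChoosable {V} vs Adj k =
  (L : V → List ℕ) → IsAssignment k L →
  Σ (V → ℕ) (λ f → IsEquitableLColouring vs Adj k L f)

-- The spider B(l₁,…,lₘ): centre u and legs u, v_{i,1}, …, v_{i,l_i}.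
-- Leg vertex v_{i,j} (j ∈ [l_i]) is  leg i j'  with j' : Fin (l i), j = j'+1.

data BVertex (m : ℕ) (l : Fin m → ℕ) : Set where
  centre : BVertex m l
  leg    : (i : Fin m) → Fin (l i) → BVertex m l

bVertices : (m : ℕ) (l : Fin m → ℕ) → List (BVertex m l)
bVertices m l = centre ∷ concatMap (λ i → map (leg i) (allFin (l i))) (allFin m)

data BEdge {m : ℕ} {l : Fin m → ℕ} : BVertex m l → BVertex m l → Set where
  first : (i : Fin m) (j : Fin (l i)) → Data.Fin.toℕ j ≡ 0 → BEdge centre (leg i j)
  next  : (i : Fin m) (j j' : Fin (l i)) →
          suc (Data.Fin.toℕ j) ≡ Data.Fin.toℕ j' → BEdge (leg i j) (leg i j')

BAdj : {m : ℕ} {l : Fin m → ℕ} → BVertex m l → BVertex m l → Set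
BAdj x y = BEdge x y ⊎ BEdge y x

Square : {V : Set} → (V → V → Set) → V → V → Set
Square {V} Adj x y = x ≢ y × (Adj x y ⊎ Σ V (λ z → Adj x z × Adj z y))

NonDecreasing : {m : ℕ} → (Fin m → ℕ) → Set
NonDecreasing {m} l = ∀ (i j : Fin m) → i ≤ᶠ j → l i ≤ l j

module Submission where

-- Enumerate the vertices as centre, leg 1, leg 2, … and colour them greedily in chunks of
-- K = m + 2 consecutive vertices, giving the vertices of a chunk pairwise distinct colours from
-- their lists; then each colour is used at most once per chunk, so at most ⌈n / K⌉ times.  A
-- chunk can be coloured in this way when, for every t ≥ 1, at most K − t of its vertices have
-- t or more neighbours among the earlier vertices: this is a Hall condition for the lists of
-- colours still allowed.  For the spider (Spider) a vertex at depth
-- ≥ 2 has at most 2 earlier neighbours, and 2 only at the start of a chunk, a first leg vertex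
-- sees the centre and the earlier first leg vertices, of which there are at most m, and every
-- full chunk after the first contains a vertex with no earlier neighbour.

open import Defs
open import Data.Nat using (ℕ; zero; suc; pred; >-nonZero; _+_; _*_; _∸_; _≤_; _<_; z≤n; s≤s; _≤?_; _%_)
open import Data.Nat.Tactic.RingSolver using (solve-∀)
open import Data.Nat.DivMod using (m≡m%n+[m/n]*n; m%n<n)
open import Data.Nat.Properties
open import Data.List using (List; []; _∷_; [_]; length; _++_; filter; map; take; drop; concat; tabulate; allFin)
open import Data.List.Properties using (take-[]; length-take; take++drop≡id; take-all; map-tabulate; length-tabulate; length-++; length-map; filter-all; filter-++; length-filter; filter-none; filter-notAll; filter-accept; filter-reject)
open import Data.List.Membership.Propositional using (_∈_; _∉_; lose)
open import Data.List.Membership.Propositional.Properties using (∈-filter⁺; ∈-filter⁻; ∈-++⁺ˡ; ∈-++⁺ʳ; ∈-++⁻; ∈-∃++; ∈-map⁺; ∈-map⁻; ∈-concatMap⁺; ∈-allFin)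
open import Data.List.Relation.Unary.Any using (here; there)
open import Data.List.Relation.Unary.All as All using (All; []; _∷_)
import Data.List.Relation.Unary.All.Properties as All
open import Data.List.Relation.Unary.Unique.Propositional using (Unique; []; _∷_)
import Data.List.Relation.Unary.Unique.Propositional.Properties as Unique
open import Data.List.Extrema.Nat using (argmax; argmax-sel; f[⊥]≤f[argmax]; f[xs]≤f[argmax])
open import Data.Product using (∃; ∃-syntax; _×_; _,_; proj₁; proj₂)
open import Data.Sum using (_⊎_; inj₁; inj₂; swap)
open import Data.Fin using (Fin; toℕ; fromℕ<) renaming (zero to fzero; suc to fsuc)
import Data.Fin.Properties as FinP
open import Data.Empty using (⊥-elim)
open import Data.Unit using (⊤; tt)
open import Function using (_∘_; id)
open import Relation.Nullary using (¬_; yes; no; contradiction)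
open import Relation.Nullary.Decidable using (¬?; _×-dec_; _⊎-dec_)
open import Relation.Unary using (Decidable)
open import Relation.Binary.Definitions using (DecidableEquality)
open import Relation.Binary.PropositionalEquality using (_≡_; _≢_; refl; sym; trans; cong; subst; module ≡-Reasoning)

module Counting {A : Set} where

  count : {P : A → Set} → Decidable P → List A → ℕ
  count P? xs = length (filter P? xs)

  module _ {P : A → Set} (P? : Decidable P) where

    count-++ : ∀ xs ys → count P? (xs ++ ys) ≡ count P? xs + count P? ys
    count-++ xs ys = trans (cong length (filter-++ P? xs ys)) (length-++ (filter P? xs))

    count-≤-length : ∀ xs → count P? xs ≤ length xs
    count-≤-length = length-filter P?

    count-none : ∀ {xs} → (∀ {x} → x ∈ xs → ¬ P x) → count P? xs ≡ 0
    count-none h = cong length (filter-none P? (All.tabulate h))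

    count-accept : ∀ {x} xs → P x → count P? (x ∷ xs) ≡ suc (count P? xs)
    count-accept xs px = cong length (filter-accept P? px)

    count-reject : ∀ {x} xs → ¬ P x → count P? (x ∷ xs) ≡ count P? xs
    count-reject xs ¬px = cong length (filter-reject P? ¬px)

    count-take : ∀ n xs → count P? (take n xs) ≤ count P? xs
    count-take n xs = begin
      count P? (take n xs)                          ≤⟨ m≤m+n _ _ ⟩
      count P? (take n xs) + count P? (drop n xs)   ≡⟨ sym (count-++ (take n xs) (drop n xs)) ⟩
      count P? (take n xs ++ drop n xs)             ≡⟨ cong (count P?) (take++drop≡id n xs) ⟩
      count P? xs                                   ∎
      where open ≤-Reasoning

    count-concat : ∀ {n} (F : Fin n → List A) → (∀ i → count P? (F i) ≤ 1) → count P? (concat (tabulate F)) ≤ n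
    count-concat {zero}  F ≤1 = z≤n
    count-concat {suc n} F ≤1 = begin
      count P? (F fzero ++ concat (tabulate (F ∘ fsuc)))  ≡⟨ count-++ (F fzero) _ ⟩
      count P? (F fzero) + count P? (concat (tabulate (F ∘ fsuc))) ≤⟨ +-mono-≤ (≤1 fzero) (count-concat (F ∘ fsuc) (≤1 ∘ fsuc)) ⟩
      suc n                                                     ∎
      where open ≤-Reasoning

    count-witness : ∀ xs → 1 ≤ count P? xs → ∃[ x ] x ∈ xs × P x
    count-witness xs pos with filter P? xs in eq
    ... | y ∷ _ = y , ∈-filter⁻ P? (subst (y ∈_) (sym eq) (here refl))

    count-delete : ∀ ys z zs → count P? (ys ++ zs) ≤ count P? (ys ++ z ∷ zs)
    count-delete ys z zs rewrite count-++ ys zs | count-++ ys (z ∷ zs) with P? z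
    ... | yes _ = +-monoʳ-≤ (count P? ys) (n≤1+n _)
    ... | no _  = ≤-refl

    count-missing : ∀ {x xs} → x ∈ xs → ¬ P x → suc (count P? xs) ≤ length xs
    count-missing x∈ ¬px = filter-notAll P? _ (lose x∈ ¬px)

    count-at-most-one : ∀ {xs} → Unique xs → (∀ {x y} → x ∈ xs → y ∈ xs → P x → P y → x ≡ y) →
                        count P? xs ≤ 1
    count-at-most-one {[]} [] same = z≤n
    count-at-most-one {x ∷ xs} (x∉ ∷ u) same with P? x
    ... | no _ = count-at-most-one u (λ y∈ z∈ → same (there y∈) (there z∈))
    ... | yes px = s≤s (≤-reflexive (count-none (λ y∈ py → All.lookup x∉ y∈ (same (here refl) (there y∈) px py))))

  module _ {P Q : A → Set} (P? : Decidable P) (Q? : Decidable Q) where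

    count-mono : ∀ {xs} → (∀ {x} → x ∈ xs → P x → Q x) → count P? xs ≤ count Q? xs
    count-mono {[]} h = z≤n
    count-mono {x ∷ xs} h with P? x | Q? x | count-mono {xs} (λ y∈ → h (there y∈))
    ... | yes px | yes _  | ih = s≤s ih
    ... | yes px | no ¬qx | ih = contradiction (h (here refl) px) ¬qx
    ... | no _   | yes _  | ih = m≤n⇒m≤1+n ih
    ... | no _   | no _   | ih = ih

    count-∪ : ∀ {R : A → Set} (R? : Decidable R) {xs} → (∀ {x} → x ∈ xs → P x → Q x ⊎ R x) →
              count P? xs ≤ count Q? xs + count R? xs
    count-∪ R? {[]} h = z≤n
    count-∪ R? {x ∷ xs} h with P? x | Q? x | R? x | count-∪ R? {xs} (λ y∈ → h (there y∈))
    ... | no _   | no _   | no _  | ih = ih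
    ... | no _   | no _   | yes _ | ih = ≤-trans ih (+-monoʳ-≤ (count Q? xs) (n≤1+n _))
    ... | no _   | yes _  | no _  | ih = m≤n⇒m≤1+n ih
    ... | no _   | yes _  | yes _ | ih = ≤-trans ih (+-mono-≤ (n≤1+n _) (n≤1+n _))
    ... | yes _  | yes _  | no _  | ih = s≤s ih
    ... | yes _  | yes _  | yes _ | ih = s≤s (≤-trans ih (+-monoʳ-≤ (count Q? xs) (n≤1+n _)))
    ... | yes _  | no _   | yes _ | ih = ≤-trans (s≤s ih) (≤-reflexive (sym (+-suc _ _)))
    ... | yes px | no ¬qx | no ¬rx | ih with h (here refl) px
    ...   | inj₁ qx = contradiction qx ¬qx
    ...   | inj₂ rx = contradiction rx ¬rx

module Colours where
  open Counting
  open import Data.List.Membership.DecPropositional _≟_ using (_∈?_)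

  allowed? : (F : List ℕ) → Decidable (_∉ F)
  allowed? F c = ¬? (c ∈? F)

  available : ∀ (F L : List ℕ) → Unique L → length L ≤ length F + count (allowed? F) L
  available F [] [] = z≤n
  available F (c ∷ L) (c∉L ∷ uL) with c ∈? F
  ... | no _ = ≤-trans (s≤s (available F L uL)) (≤-reflexive (sym (+-suc _ _)))
  ... | yes c∈F = begin
      suc (length L)                                  ≤⟨ s≤s (available F' L uL) ⟩
      suc (length F' + count (allowed? F') L)         ≤⟨ +-mono-≤ F'<F (count-mono (allowed? F') (allowed? F) still-allowed) ⟩
      length F + count (allowed? F) L                 ∎
    where
    open ≤-Reasoning
    -- F without the colour c, which no longer matters for the rest of L
    F' : List ℕ
    F' = filter (λ d → ¬? (d ≟ c)) F
    F'<F : suc (length F') ≤ length F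
    F'<F = filter-notAll (λ d → ¬? (d ≟ c)) F (lose c∈F (λ c≢c → c≢c refl))
    still-allowed : ∀ {d} → d ∈ L → d ∉ F' → d ∉ F
    still-allowed d∈L d∉F' d∈F = d∉F' (∈-filter⁺ (λ d → ¬? (d ≟ c)) d∈F (λ d≡c → All.lookup c∉L d∈L (sym d≡c)))

  fresh : ∀ (F L : List ℕ) → Unique L → length F < length L → ∃[ c ] c ∈ L × c ∉ F
  fresh F L uL F<L = count-witness (allowed? F) L (+-cancelˡ-≤ (length F) 1 _ (begin
      length F + 1                   ≡⟨ +-comm (length F) 1 ⟩
      suc (length F)                 ≤⟨ F<L ⟩
      length L                       ≤⟨ available F L uL ⟩
      length F + count (allowed? F) L ∎))
    where open ≤-Reasoning

module DistinctRepresentatives {V : Set} (_≟_ : DecidableEquality V) where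
  open Counting
  open Colours using (fresh)

  HallCondition : (V → List ℕ) → List V → Set
  HallCondition A C = ∀ s → count (λ x → length (A x) ≤? s) C ≤ s

  Representatives : (V → List ℕ) → List V → (V → ℕ) → Set
  Representatives A C g = (∀ {x} → x ∈ C → g x ∈ A x) × (∀ {x y} → x ∈ C → y ∈ C → x ≢ y → g x ≢ g y)

  ∈-delete : ∀ (ys : List V) {z : V} {zs y} → y ∈ ys ++ [ z ] ++ zs → y ≢ z → y ∈ ys ++ zs
  ∈-delete ys y∈ y≢z with ∈-++⁻ ys y∈
  ... | inj₁ y∈ys = ∈-++⁺ˡ y∈ys
  ... | inj₂ (here y≡z) = contradiction y≡z y≢z
  ... | inj₂ (there y∈zs) = ∈-++⁺ʳ ys y∈zs

  longest : (size : V → ℕ) → ∀ x xs → ∃[ z ] z ∈ x ∷ xs × All (λ y → size y ≤ size z) (x ∷ xs)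
  longest size x xs = argmax size x xs , member , f[⊥]≤f[argmax] {f = size} x xs ∷ f[xs]≤f[argmax] {f = size} x xs
    where
    member : argmax size x xs ∈ x ∷ xs
    member with argmax-sel size x xs
    ... | inj₁ z≡x = here z≡x
    ... | inj₂ z∈xs = there z∈xs

  add-member : ∀ ys z zs (A : V → List ℕ) → Unique (A z) → length (ys ++ zs) < length (A z) →
               ∀ {g'} → Representatives A (ys ++ zs) g' → ∃ (Representatives A (ys ++ [ z ] ++ zs))
  add-member ys z zs A uAz short {g'} (g'∈A , g'-injective)
    with fresh (map g' (ys ++ zs)) (A z) uAz (subst (_< length (A z)) (sym (length-map g' (ys ++ zs))) short)
  ... | c , c∈Az , c-unused = g , g∈A , g-injective
    where
    g : V → ℕ
    g y with y ≟ z
    ... | yes _ = c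
    ... | no _ = g' y
    g∈A : ∀ {y} → y ∈ ys ++ [ z ] ++ zs → g y ∈ A y
    g∈A {y} y∈ with y ≟ z
    ... | yes refl = c∈Az
    ... | no y≢z = g'∈A (∈-delete ys y∈ y≢z)
    g'-avoids-c : ∀ {y} → y ∈ ys ++ [ z ] ++ zs → y ≢ z → g' y ≢ c
    g'-avoids-c y∈ y≢z g'y≡c = c-unused (subst (_∈ map g' (ys ++ zs)) g'y≡c (∈-map⁺ g' (∈-delete ys y∈ y≢z)))
    g-injective : ∀ {y w} → y ∈ ys ++ [ z ] ++ zs → w ∈ ys ++ [ z ] ++ zs → y ≢ w → g y ≢ g w
    g-injective {y} {w} y∈ w∈ y≢w with y ≟ z | w ≟ z
    ... | yes refl | yes refl = contradiction refl y≢w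
    ... | yes refl | no w≢z   = λ c≡g'w → g'-avoids-c w∈ w≢z (sym c≡g'w)
    ... | no y≢z   | yes refl = g'-avoids-c y∈ y≢z
    ... | no y≢z   | no w≢z   = g'-injective (∈-delete ys y∈ y≢z) (∈-delete ys w∈ w≢z) y≢w

  -- Induction on |C|: a member z with the longest list satisfies |C| ≤ |A z| by the Hall
  -- condition for s = |A z|, and the Hall condition passes to C − z.
  representatives : ∀ n (C : List V) → length C ≡ n → (A : V → List ℕ) → (∀ x → Unique (A x)) →
                    HallCondition A C → ∃ (Representatives A C)
  representatives _ [] _ A uA hall = (λ _ → 0) , (λ ()) , (λ ())
  representatives (suc n) (x ∷ xs) |C|≡ A uA hall with longest (λ y → length (A y)) x xs
  ... | z , z∈C , all-short with ∈-∃++ z∈C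
  ...   | ys , zs , C≡ = subst (λ D → ∃ (Representatives A D)) (sym C≡)
                           (add-member ys z zs A (uA z) short (proj₂ (representatives n (ys ++ zs) |C'|≡ A uA hall')))
    where
    |C'|≡ : length (ys ++ zs) ≡ n
    |C'|≡ = suc-injective (begin
      suc (length (ys ++ zs))      ≡⟨ cong suc (length-++ ys) ⟩
      suc (length ys + length zs)  ≡⟨ sym (+-suc (length ys) (length zs)) ⟩
      length ys + length (z ∷ zs)  ≡⟨ sym (length-++ ys) ⟩
      length (ys ++ [ z ] ++ zs)   ≡⟨ cong length (sym C≡) ⟩
      length (x ∷ xs)              ≡⟨ |C|≡ ⟩
      suc n                        ∎)
      where open ≡-Reasoning
    hall' : HallCondition A (ys ++ zs)
    hall' s = ≤-trans (count-delete _ ys z zs) (subst (λ D → count (λ y → length (A y) ≤? s) D ≤ s) C≡ (hall s))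
    -- all of C is counted by the Hall condition for s = |A z|
    C≤Az : length (x ∷ xs) ≤ length (A z)
    C≤Az = subst (_≤ length (A z)) (cong length (filter-all (λ y → length (A y) ≤? length (A z)) all-short)) (hall (length (A z)))
    short : length (ys ++ zs) < length (A z)
    short = ≤-trans (s≤s (≤-reflexive |C'|≡)) (subst (_≤ length (A z)) |C|≡ C≤Az)

module Prefixes {A : Set} where

  take-+ : ∀ m n (xs : List A) → take (m + n) xs ≡ take m xs ++ take n (drop m xs)
  take-+ zero    n xs       = refl
  take-+ (suc m) n []       = sym (take-[] n)
  take-+ (suc m) n (x ∷ xs) = cong (x ∷_) (take-+ m n xs)

  ∈-take : ∀ n {x} {xs : List A} → x ∈ take n xs → x ∈ xs
  ∈-take (suc n) {xs = y ∷ xs} (here x≡y) = here x≡y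
  ∈-take (suc n) {xs = y ∷ xs} (there x∈) = there (∈-take n x∈)

  length-take-≤ : ∀ n (xs : List A) → length (take n xs) ≤ n
  length-take-≤ n xs = ≤-trans (≤-reflexive (length-take n xs)) (m⊓n≤m n (length xs))

  prefix-disjoint : ∀ {xs : List A} → Unique xs → ∀ p n {x} → x ∈ take p xs → x ∉ take n (drop p xs)
  prefix-disjoint {xs} uxs p n x∈pre x∈C =
    All.lookup (lookup-disjoint (subst Unique (sym (take++drop≡id p xs)) uxs) x∈pre) (∈-take n x∈C) refl
    where
    lookup-disjoint : ∀ {ys zs : List A} → Unique (ys ++ zs) → ∀ {y} → y ∈ ys → All (y ≢_) zs
    lookup-disjoint {y ∷ ys} (y∉ ∷ _) (here refl) = All.++⁻ʳ ys y∉
    lookup-disjoint {y ∷ ys} (_ ∷ u)  (there y∈) = lookup-disjoint u y∈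

-- Each chunk of k consecutive vertices receives pairwise distinct colours (a system of
-- distinct representatives of the colours not yet blocked), so after q chunks every colour
-- has been used at most q times.  Adjacency is over-approximated by a decidable relation
-- Near, and a vertex x of a chunk loses at most backDegree pre x colours to the already
-- coloured prefix pre.
module ChunkedGreedy {V : Set} (_≟V_ : DecidableEquality V) (Adj : V → V → Set)
    {Near : V → V → Set} (near? : ∀ x → Decidable (Near x))
    (adj⇒near : ∀ {x y} → Adj x y → Near x y) (adj-sym : ∀ {x y} → Adj x y → Adj y x)
    (adj-irrefl : ∀ {x y} → Adj x y → x ≢ y)
    (k₀ : ℕ) where

  open Counting
  open Colours using (allowed?; available)
  open DistinctRepresentatives _≟V_ using (HallCondition; representatives)
  open Prefixes
  open import Data.List.Membership.DecPropositional _≟V_ using (_∈?_)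

  k : ℕ
  k = suc k₀

  backDegree : List V → V → ℕ
  backDegree pre x = count (near? x) pre

  ChunkCondition : List V → List V → Set
  ChunkCondition pre C = ∀ t → 1 ≤ t → t ≤ k → count (λ x → t ≤? backDegree pre x) C + t ≤ k

  Partial : (V → List ℕ) → ℕ → List V → (V → ℕ) → Set
  Partial L q pre f = (∀ v → f v ∈ L v) × (∀ {u v} → u ∈ pre → v ∈ pre → Adj u v → f u ≢ f v) ×
                      (∀ c → count (λ v → f v ≟ c) pre ≤ q)

  -- a vertex with at least k − s available colours has at most s of them only if it has at
  -- least k − s Near-neighbours in pre; so the chunk condition yields the Hall condition
  chunk⇒hall : ∀ {pre C} (A : V → List ℕ) → length C ≤ k → ChunkCondition pre C →
               (∀ x → k ≤ backDegree pre x + length (A x)) → HallCondition A C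
  chunk⇒hall {pre} {C} A |C|≤k chunk enough s with k ≤? s
  ... | yes k≤s = ≤-trans (count-≤-length _ C) (≤-trans |C|≤k k≤s)
  ... | no k≰s = begin
      count (λ x → length (A x) ≤? s) C        ≤⟨ count-mono _ _ blocked ⟩
      count (λ x → k ∸ s ≤? backDegree pre x) C ≤⟨ m+n≤o⇒m≤o∸n _ (chunk (k ∸ s) (m<n⇒0<n∸m s<k) (m∸n≤m k s)) ⟩
      k ∸ (k ∸ s)                               ≡⟨ m∸[m∸n]≡n (<⇒≤ s<k) ⟩
      s                                         ∎
    where
    open ≤-Reasoning
    s<k : s < k
    s<k = ≰⇒> k≰s
    blocked : ∀ {x} → x ∈ C → length (A x) ≤ s → k ∸ s ≤ backDegree pre x
    blocked {x} _ |Ax|≤s = m≤n+o⇒m∸n≤o k s (≤-trans (enough x) (≤-trans (+-monoʳ-≤ _ |Ax|≤s) (≤-reflexive (+-comm _ s))))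

  Allowed : (V → List ℕ) → (V → ℕ) → List V → V → List ℕ
  Allowed L f pre x = filter (allowed? (map f (filter (near? x) pre))) (L x)

  module _ {L : V → List ℕ} (isL : IsAssignment k L) (f : V → ℕ) (pre : List V) where

    allowed-enough : ∀ x → k ≤ backDegree pre x + length (Allowed L f pre x)
    allowed-enough x = subst (_≤ backDegree pre x + length (Allowed L f pre x)) (proj₁ (isL x))
      (subst (λ b → length (L x) ≤ b + length (Allowed L f pre x)) (length-map f (filter (near? x) pre))
        (available (map f (filter (near? x) pre)) (L x) (proj₂ (isL x))))

    allowed-unique : ∀ x → Unique (Allowed L f pre x)
    allowed-unique x = Unique.filter⁺ _ (proj₂ (isL x))

    allowed-in-list : ∀ {x c} → c ∈ Allowed L f pre x → c ∈ L x
    allowed-in-list {x} c∈ = proj₁ (∈-filter⁻ (allowed? _) {xs = L x} c∈)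

    allowed-avoids : ∀ {x y c} → c ∈ Allowed L f pre x → y ∈ pre → Adj x y → c ≢ f y
    allowed-avoids {x} c∈ y∈ adj c≡fy = proj₂ (∈-filter⁻ (allowed? _) {xs = L x} c∈)
      (subst (_∈ map f (filter (near? x) pre)) (sym c≡fy) (∈-map⁺ f (∈-filter⁺ (near? x) y∈ (adj⇒near adj))))

  override : List V → (V → ℕ) → (V → ℕ) → V → ℕ
  override C g f x with x ∈? C
  ... | yes _ = g x
  ... | no _  = f x

  override-in : ∀ {C g f x} → x ∈ C → override C g f x ≡ g x
  override-in {C} {x = x} x∈ with x ∈? C
  ... | yes _   = refl
  ... | no x∉C  = contradiction x∈ x∉C

  override-out : ∀ {C g f x} → x ∉ C → override C g f x ≡ f x
  override-out {C} {x = x} x∉ with x ∈? C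
  ... | yes x∈C = contradiction x∈C x∉
  ... | no _    = refl

  -- Colouring one more chunk C: the vertices of C receive distinct allowed colours, so the
  -- colouring stays proper and each colour gains at most one use.
  extend-by-chunk : ∀ (L : V → List ℕ) → IsAssignment k L → ∀ {q pre C f} →
    Unique C → (∀ {x} → x ∈ pre → x ∉ C) → length C ≤ k → ChunkCondition pre C →
    Partial L q pre f → ∃ (Partial L (suc q) (pre ++ C))
  extend-by-chunk L isL {q} {pre} {C} {f} uC disjoint |C|≤k chunk (f∈L , f-proper , f-equitable)
    with representatives _ C refl (Allowed L f pre) (allowed-unique isL f pre)
           (chunk⇒hall {pre} {C} (Allowed L f pre) |C|≤k chunk (allowed-enough isL f pre))
  ... | g , g∈A , g-injective = f' , f'∈L , f'-proper , f'-equitable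
    where
    f' : V → ℕ
    f' = override C g f
    f'-pre : ∀ {x} → x ∈ pre → f' x ≡ f x
    f'-pre x∈ = override-out (disjoint x∈)
    f'∈L : ∀ v → f' v ∈ L v
    f'∈L v with v ∈? C
    ... | yes v∈C = allowed-in-list isL f pre (g∈A v∈C)
    ... | no _    = f∈L v
    f'-proper : ∀ {u v} → u ∈ pre ++ C → v ∈ pre ++ C → Adj u v → f' u ≢ f' v
    f'-proper u∈ v∈ adj with ∈-++⁻ pre u∈ | ∈-++⁻ pre v∈
    ... | inj₁ u∈pre | inj₁ v∈pre rewrite f'-pre u∈pre | f'-pre v∈pre = f-proper u∈pre v∈pre adj
    ... | inj₂ u∈C   | inj₂ v∈C   rewrite override-in {g = g} {f} u∈C | override-in {g = g} {f} v∈C =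
          g-injective u∈C v∈C (adj-irrefl adj)
    ... | inj₂ u∈C   | inj₁ v∈pre rewrite override-in {g = g} {f} u∈C | f'-pre v∈pre =
          allowed-avoids isL f pre (g∈A u∈C) v∈pre adj
    ... | inj₁ u∈pre | inj₂ v∈C   rewrite f'-pre u∈pre | override-in {g = g} {f} v∈C =
          λ fu≡gv → allowed-avoids isL f pre (g∈A v∈C) u∈pre (adj-sym adj) (sym fu≡gv)
    once-on-chunk : ∀ c → count (λ v → f' v ≟ c) C ≤ 1
    once-on-chunk c = count-at-most-one _ uC same
      where
      same : ∀ {x y} → x ∈ C → y ∈ C → f' x ≡ c → f' y ≡ c → x ≡ y
      same {x} {y} x∈ y∈ f'x≡c f'y≡c with x ≟V y
      ... | yes x≡y = x≡y
      ... | no x≢y  = contradiction (trans (sym (override-in x∈)) (trans f'x≡c (trans (sym f'y≡c) (override-in y∈))))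
                                    (g-injective x∈ y∈ x≢y)
    f'-equitable : ∀ c → count (λ v → f' v ≟ c) (pre ++ C) ≤ suc q
    f'-equitable c = begin
      count (λ v → f' v ≟ c) (pre ++ C)                       ≡⟨ count-++ _ pre C ⟩
      count (λ v → f' v ≟ c) pre + count (λ v → f' v ≟ c) C  ≤⟨ +-mono-≤ on-pre (once-on-chunk c) ⟩
      q + 1                                                   ≡⟨ +-comm q 1 ⟩
      suc q                                                   ∎
      where
      open ≤-Reasoning
      on-pre : count (λ v → f' v ≟ c) pre ≤ q
      on-pre = ≤-trans (count-mono _ _ (λ x∈ f'x≡c → trans (sym (f'-pre x∈)) f'x≡c)) (f-equitable c)

  covered : ∀ n → n ≤ ceilDiv n k * k
  covered n = +-cancelʳ-≤ k₀ n (ceilDiv n k * k) (begin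
      n + k₀                                   ≡⟨ m≡m%n+[m/n]*n (n + k₀) k ⟩
      (n + k₀) % k + ceilDiv n k * k           ≤⟨ +-monoˡ-≤ _ (≤-pred (m%n<n (n + k₀) k)) ⟩
      k₀ + ceilDiv n k * k                     ≡⟨ +-comm k₀ _ ⟩
      ceilDiv n k * k + k₀                     ∎)
    where open ≤-Reasoning

  module _ (vs : List V) (uvs : Unique vs) (all-vs : ∀ v → v ∈ vs)
           (chunks : ∀ q → ChunkCondition (take (q * k) vs) (take k (drop (q * k) vs))) where

    colour-chunks : ∀ L → IsAssignment k L → ∀ q → ∃ (Partial L q (take (q * k) vs))
    colour-chunks L isL zero = (λ v → proj₁ (some-colour v)) , (λ v → proj₂ (some-colour v)) , (λ ()) , (λ _ → z≤n)
      where
      some-colour : ∀ v → ∃ (_∈ L v)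
      some-colour v with L v | proj₁ (isL v)
      ... | c ∷ _ | _ = c , here refl
    colour-chunks L isL (suc q) with colour-chunks L isL q
    ... | f , partial = subst (λ pre → ∃ (Partial L (suc q) pre)) (sym prefix≡)
        (extend-by-chunk L isL {f = f} (Unique.take⁺ k (Unique.drop⁺ (q * k) uvs))
           (prefix-disjoint uvs (q * k) k) (length-take-≤ k (drop (q * k) vs)) (chunks q) partial)
      where
      prefix≡ : take (suc q * k) vs ≡ take (q * k) vs ++ take k (drop (q * k) vs)
      prefix≡ = trans (cong (λ n → take n vs) (+-comm k (q * k))) (take-+ (q * k) k vs)

    equitably-choosable : EquitablyChoosable vs Adj k
    equitably-choosable L isL
      with subst (λ pre → ∃ (Partial L q pre)) (take-all (q * k) vs (covered (length vs))) (colour-chunks L isL q)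
      where q = ceilDiv (length vs) k
    ... | f , f∈L , f-proper , f-equitable = f , f∈L , (λ u v adj → f-proper (all-vs u) (all-vs v) adj) , f-equitable

-- Of the c positions P − c, …, P − 1 (with c ≤ P), exactly p ∸ (P ∸ c) lie below p.
module WindowArithmetic where

  window-≤ : ∀ {c p P} → c ≤ P → p ≤ P → p ∸ (P ∸ c) ≤ c
  window-≤ {c} {p} {P} c≤P p≤P = ≤-trans (∸-monoˡ-≤ (P ∸ c) p≤P) (≤-reflexive (m∸[m∸n]≡n c≤P))

  window-full : ∀ {c p P} → 1 ≤ c → c ≤ P → c ≤ p ∸ (P ∸ c) → P ≤ p
  window-full {c} {p} {P} 1≤c c≤P full = begin
      P                ≡⟨ sym (m∸n+n≡m c≤P) ⟩
      (P ∸ c) + c      ≡⟨ +-comm (P ∸ c) c ⟩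
      c + (P ∸ c)      ≤⟨ m≤o∸n⇒m+n≤o c (<⇒≤ (m∸n≢0⇒n<m nonempty)) full ⟩
      p                ∎
    where
    open ≤-Reasoning
    nonempty : p ∸ (P ∸ c) ≢ 0
    nonempty empty = contradiction (≤-trans 1≤c (subst (c ≤_) empty full)) λ ()

  window-empty : ∀ {c p P} → p + c ≤ P → p ∸ (P ∸ c) ≡ 0
  window-empty {c} {p} p+c≤P = m≤n⇒m∸n≡0 (m+n≤o⇒m≤o∸n p {c} p+c≤P)

module Spider (m : ℕ) (l : Fin m → ℕ) where
  open Counting
  open Prefixes using (take-+; length-take-≤)
  open WindowArithmetic

  V : Set
  V = BVertex m l

  _≟V_ : DecidableEquality V
  centre  ≟V centre   = yes refl
  centre  ≟V leg _ _  = no λ ()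
  leg _ _ ≟V centre   = no λ ()
  leg i j ≟V leg i' j' with i FinP.≟ i'
  ... | no i≢i' = no λ { refl → i≢i' refl }
  ... | yes refl with j FinP.≟ j'
  ...   | yes refl = yes refl
  ...   | no j≢j' = no λ { refl → j≢j' refl }

  depth : V → ℕ
  depth centre    = 0
  depth (leg i j) = suc (toℕ j)

  Close : ℕ → ℕ → Set
  Close a b = a ≤ b + 2 × b ≤ a + 2

  -- x and y are equal or at distance at most 2 in B(l)
  Near : V → V → Set
  Near centre y              = depth y ≤ 2
  Near (leg i j) centre      = toℕ j ≤ 1
  Near (leg i j) (leg i' j') = (i ≡ i' × Close (toℕ j) (toℕ j')) ⊎ (toℕ j ≡ 0 × toℕ j' ≡ 0)

  near? : ∀ x → Decidable (Near x)
  near? centre y              = depth y ≤? 2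
  near? (leg i j) centre      = toℕ j ≤? 1
  near? (leg i j) (leg i' j') = (i FinP.≟ i' ×-dec (toℕ j ≤? toℕ j' + 2 ×-dec toℕ j' ≤? toℕ j + 2))
                                ⊎-dec (toℕ j ≟ 0 ×-dec toℕ j' ≟ 0)

  close-refl : ∀ {a b} → a ≡ b → Close a b
  close-refl refl = m≤m+n _ 2 , m≤m+n _ 2

  close-sym : ∀ {a b} → Close a b → Close b a
  close-sym (a≤b+2 , b≤a+2) = b≤a+2 , a≤b+2

  close-step : ∀ {a b} → suc a ≡ b → Close a b
  close-step {a} refl = ≤-trans (n≤1+n a) (m≤m+n _ 2) , m<m+n a (s≤s z≤n)

  close-two : ∀ {a b c} → suc a ≡ b → suc b ≡ c → Close a c
  close-two {a} refl refl = ≤-trans (≤-trans (n≤1+n a) (n≤1+n _)) (m≤m+n _ 2) , ≤-reflexive (+-comm 2 a)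

  edge⇒near : ∀ {x y} → BEdge x y → Near x y × Near y x
  edge⇒near (first i j j≡0)   rewrite j≡0 = s≤s z≤n , z≤n
  edge⇒near (next i j j' 1+j≡j') = inj₁ (refl , close-step 1+j≡j') , inj₁ (refl , close-sym (close-step 1+j≡j'))

  adj⇒near : ∀ {x y} → BAdj x y → Near x y
  adj⇒near (inj₁ e) = proj₁ (edge⇒near e)
  adj⇒near (inj₂ e) = proj₂ (edge⇒near e)

  path⇒near : ∀ {x z y} → BAdj x z → BAdj z y → Near x y
  path⇒near (inj₁ (first i j j≡0))   (inj₁ (next _ _ j' 1+j≡j')) rewrite sym 1+j≡j' | j≡0 = ≤-refl
  path⇒near (inj₁ (first i j j≡0))   (inj₂ (first _ _ _))        = z≤n
  path⇒near (inj₁ (first i j j≡0))   (inj₂ (next _ c _ 1+c≡j))   = contradiction (trans 1+c≡j j≡0) λ ()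
  path⇒near (inj₁ (next i a b 1+a≡b)) (inj₁ (next _ _ c 1+b≡c)) = inj₁ (refl , close-two 1+a≡b 1+b≡c)
  path⇒near (inj₁ (next i a b 1+a≡b)) (inj₂ (next _ c _ 1+c≡b)) = inj₁ (refl , close-refl (suc-injective (trans 1+a≡b (sym 1+c≡b))))
  path⇒near (inj₁ (next i a b 1+a≡b)) (inj₂ (first _ _ b≡0))    = contradiction (trans 1+a≡b b≡0) λ ()
  path⇒near (inj₂ (first i j j≡0))   (inj₁ (first i' j' j'≡0))  = inj₂ (j≡0 , j'≡0)
  path⇒near (inj₂ (next i b a 1+b≡a)) (inj₁ (next _ _ c 1+b≡c)) = inj₁ (refl , close-refl (trans (sym 1+b≡a) 1+b≡c))
  path⇒near (inj₂ (next i b a 1+b≡a)) (inj₂ (next _ c _ 1+c≡b)) = inj₁ (refl , close-sym (close-two 1+c≡b 1+b≡a))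
  path⇒near (inj₂ (next i b a 1+b≡a)) (inj₂ (first _ _ b≡0))    rewrite sym 1+b≡a | b≡0 = ≤-refl

  Adj² : V → V → Set
  Adj² = Square BAdj

  adj²⇒near : ∀ {x y} → Adj² x y → Near x y
  adj²⇒near (_ , inj₁ adj)               = adj⇒near adj
  adj²⇒near (_ , inj₂ (_ , adj₁ , adj₂)) = path⇒near adj₁ adj₂

  adj²-sym : ∀ {x y} → Adj² x y → Adj² y x
  adj²-sym (x≢y , inj₁ adj)               = (λ y≡x → x≢y (sym y≡x)) , inj₁ (swap adj)
  adj²-sym (x≢y , inj₂ (z , adj₁ , adj₂)) = (λ y≡x → x≢y (sym y≡x)) , inj₂ (z , swap adj₂ , swap adj₁)

  adj²-irrefl : ∀ {x y} → Adj² x y → x ≢ y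
  adj²-irrefl = proj₁

  offset : ∀ {n} → (Fin n → ℕ) → Fin n → ℕ
  offset ls fzero    = 0
  offset ls (fsuc i) = ls fzero + offset (ls ∘ fsuc) i

  -- the index of a vertex in the enumeration bVertices m l
  pos : V → ℕ
  pos centre    = 0
  pos (leg i j) = suc (offset l i + toℕ j)

  Consecutive : ℕ → List V → Set
  Consecutive s []       = ⊤
  Consecutive s (x ∷ xs) = pos x ≡ s × Consecutive (suc s) xs

  consecutive-++ : ∀ {s} xs {ys} → Consecutive s xs → Consecutive (s + length xs) ys → Consecutive s (xs ++ ys)
  consecutive-++ {s} []       _        cys rewrite +-identityʳ s = cys
  consecutive-++ {s} (x ∷ xs) {ys} (e , cxs) cys = e , consecutive-++ xs cxs (subst (λ t → Consecutive t ys) (+-suc s (length xs)) cys)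

  consecutive-tabulate : ∀ {n} s (h : Fin n → V) → (∀ j → pos (h j) ≡ s + toℕ j) → Consecutive s (tabulate h)
  consecutive-tabulate {zero}  s h pos-h = tt
  consecutive-tabulate {suc n} s h pos-h = trans (pos-h fzero) (+-identityʳ s) ,
    consecutive-tabulate (suc s) (h ∘ fsuc) (λ j → trans (pos-h (fsuc j)) (+-suc s (toℕ j)))

  consecutive-concat : ∀ {n} s (F : Fin n → List V) (len : Fin n → ℕ) → (∀ i → length (F i) ≡ len i) →
                       (∀ i → Consecutive (s + offset len i) (F i)) → Consecutive s (concat (tabulate F))
  consecutive-concat {zero}  s F len |F|≡ cF = tt
  consecutive-concat {suc n} s F len |F|≡ cF =
    consecutive-++ (F fzero) (subst (λ t → Consecutive t _) (+-identityʳ s) (cF fzero))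
      (consecutive-concat (s + length (F fzero)) (F ∘ fsuc) (len ∘ fsuc) (|F|≡ ∘ fsuc)
        (λ i → subst (λ t → Consecutive t (F (fsuc i))) (shift i) (cF (fsuc i))))
    where
    shift : ∀ i → s + offset len (fsuc i) ≡ s + length (F fzero) + offset (len ∘ fsuc) i
    shift i rewrite |F|≡ fzero = sym (+-assoc s _ _)

  vertices : List V
  vertices = bVertices m l

  row : Fin m → List V
  row i = map (leg i) (allFin (l i))

  vertices-consecutive : Consecutive 0 vertices
  vertices-consecutive = refl , subst (Consecutive 1) (cong concat (sym (map-tabulate id row)))
    (consecutive-concat 1 row l |row|≡ (λ i → subst (Consecutive (suc (offset l i))) (sym (map-tabulate id (leg i)))
      (consecutive-tabulate (suc (offset l i)) (leg i) (λ j → refl))))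
    where
    |row|≡ : ∀ i → length (row i) ≡ l i
    |row|≡ i = trans (length-map (leg {m} {l} i) (allFin (l i))) (length-tabulate {n = l i} id)

  all-vertices : ∀ v → v ∈ vertices
  all-vertices centre    = here refl
  all-vertices (leg i j) = there (∈-concatMap⁺ row (lose (∈-allFin i) (∈-map⁺ (leg i) (∈-allFin j))))


  consecutive-range : ∀ {s xs x} → Consecutive s xs → x ∈ xs → s ≤ pos x × pos x < s + length xs
  consecutive-range {s} {y ∷ xs} (refl , _) (here refl) = ≤-refl , m<m+n s (s≤s z≤n)
  consecutive-range {s} {y ∷ xs} (_ , cxs) (there x∈) with consecutive-range cxs x∈
  ... | s<x , x<end = <⇒≤ s<x , ≤-trans x<end (≤-reflexive (sym (+-suc s (length xs))))

  later-position : ∀ {s xs x} → Consecutive (suc s) xs → x ∈ xs → pos x ≢ s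
  later-position cxs x∈ x≡s = 1+n≰n (subst (_ ≤_) x≡s (proj₁ (consecutive-range cxs x∈)))

  consecutive-injective : ∀ {s xs x y} → Consecutive s xs → x ∈ xs → y ∈ xs → pos x ≡ pos y → x ≡ y
  consecutive-injective _         (here refl) (here refl) _   = refl
  consecutive-injective (e , cxs) (here refl) (there y∈)  x≡y = contradiction (trans (sym x≡y) e) (later-position cxs y∈)
  consecutive-injective (e , cxs) (there x∈)  (here refl) x≡y = contradiction (trans x≡y e) (later-position cxs x∈)
  consecutive-injective (_ , cxs) (there x∈)  (there y∈)  x≡y = consecutive-injective cxs x∈ y∈ x≡y

  consecutive-unique : ∀ {s xs} → Consecutive s xs → Unique xs
  consecutive-unique {xs = []}     _         = []
  consecutive-unique {xs = x ∷ xs} (e , cxs) =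
    All.tabulate (λ y∈ x≡y → later-position cxs y∈ (trans (cong pos (sym x≡y)) e)) ∷ consecutive-unique cxs

  consecutive-at : ∀ {s xs} → Consecutive s xs → ∀ P → s ≤ P → P < s + length xs → ∃[ x ] x ∈ xs × pos x ≡ P
  consecutive-at {s} {[]}     _         P s≤P P<s+0 = contradiction (≤-trans P<s+0 (≤-trans (≤-reflexive (+-identityʳ s)) s≤P)) 1+n≰n
  consecutive-at {s} {x ∷ xs} (e , cxs) P s≤P P<end with s ≟ P
  ... | yes refl = x , here refl , e
  ... | no s≢P with consecutive-at cxs P (≤∧≢⇒< s≤P s≢P) (≤-trans P<end (≤-reflexive (+-suc s (length xs))))
  ...   | y , y∈ , y≡P = y , there y∈ , y≡P

  consecutive-take : ∀ n {s xs} → Consecutive s xs → Consecutive s (take n xs)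
  consecutive-take zero    {xs = _}      _         = tt
  consecutive-take (suc n) {xs = []}     _         = tt
  consecutive-take (suc n) {xs = x ∷ xs} (e , cxs) = e , consecutive-take n cxs

  consecutive-drop : ∀ n {s xs} → Consecutive s xs → Consecutive (n + s) (drop n xs)
  consecutive-drop zero    {xs = _}      cxs       = cxs
  consecutive-drop (suc n) {xs = []}     _         = tt
  consecutive-drop (suc n) {s} {x ∷ xs} (_ , cxs) = subst (λ t → Consecutive t (drop n xs)) (+-suc n s) (consecutive-drop n cxs)

  window-count : ∀ r {s xs} → Consecutive s xs → count (λ w → r ≤? pos w) xs ≤ (s + length xs) ∸ r
  window-count r {s} {[]}     _         = z≤n
  window-count r {s} {x ∷ xs} (e , cxs) with r ≤? pos x
  ... | yes r≤x = begin
      count (λ w → r ≤? pos w) (x ∷ xs)  ≡⟨ count-accept _ xs r≤x ⟩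
      suc (count (λ w → r ≤? pos w) xs)  ≤⟨ s≤s (count-≤-length _ xs) ⟩
      suc (length xs)                    ≤⟨ m≤n+m _ (s ∸ r) ⟩
      (s ∸ r) + suc (length xs)          ≡⟨ sym (+-∸-comm (suc (length xs)) (subst (r ≤_) e r≤x)) ⟩
      (s + suc (length xs)) ∸ r          ∎
    where open ≤-Reasoning
  ... | no r≰x = begin
      count (λ w → r ≤? pos w) (x ∷ xs)  ≡⟨ count-reject _ xs r≰x ⟩
      count (λ w → r ≤? pos w) xs        ≤⟨ window-count r cxs ⟩
      (suc s + length xs) ∸ r            ≡⟨ cong (_∸ r) (sym (+-suc s (length xs))) ⟩
      (s + suc (length xs)) ∸ r          ∎
    where open ≤-Reasoning

  consecutive-first : ∀ {s xs} → Consecutive s xs → count (λ w → pos w ≤? s) xs ≤ 1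
  consecutive-first cxs = count-at-most-one _ (consecutive-unique cxs)
    (λ x∈ y∈ x≤s y≤s → consecutive-injective cxs x∈ y∈
       (trans (≤-antisym x≤s (proj₁ (consecutive-range cxs x∈))) (sym (≤-antisym y≤s (proj₁ (consecutive-range cxs y∈))))))

  Start : V → Set
  Start x = depth x ≡ 1

  start? : Decidable Start
  start? x = depth x ≟ 1

  -- The earlier Near-neighbours w of a leg vertex x = leg i j: for j ≥ 2 only its two
  -- predecessors on the leg, for j = 1 the centre and its predecessor, for j = 0 the
  -- centre and the first vertices of the other legs.
  near-deep : ∀ {i j w} → 2 ≤ toℕ j → Near (leg i j) w → pos (leg i j) ≤ pos w + 2
  near-deep {w = centre}  2≤j j≤1 = contradiction (≤-trans 2≤j j≤1) λ { (s≤s ()) }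
  near-deep {i} {w = leg _ j'} 2≤j (inj₁ (refl , j≤j'+2 , _)) =
    s≤s (≤-trans (+-monoʳ-≤ (offset l i) j≤j'+2) (≤-reflexive (sym (+-assoc (offset l i) (toℕ j') 2))))
  near-deep {w = leg _ _} 2≤j (inj₂ (j≡0 , _)) = contradiction (subst (2 ≤_) j≡0 2≤j) λ ()

  near-second : ∀ {i j w} → toℕ j ≡ 1 → Near (leg i j) w → w ≡ centre ⊎ pos (leg i j) ≤ pos w + 1
  near-second {w = centre} _ _ = inj₁ refl
  near-second {i} {j} {leg _ j'} j≡1 (inj₁ (refl , _)) = inj₂ (s≤s (begin
    offset l i + toℕ j       ≡⟨ cong (offset l i +_) (trans j≡1 (sym (+-identityˡ 1))) ⟩
    offset l i + (0 + 1)     ≤⟨ +-monoʳ-≤ (offset l i) (+-monoˡ-≤ 1 z≤n) ⟩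
    offset l i + (toℕ j' + 1) ≡⟨ sym (+-assoc (offset l i) (toℕ j') 1) ⟩
    offset l i + toℕ j' + 1  ∎))
    where open ≤-Reasoning
  near-second {w = leg _ _} j≡1 (inj₂ (j≡0 , _)) = contradiction (trans (sym j≡1) j≡0) λ ()

  near-first : ∀ {i j w} → toℕ j ≡ 0 → Near (leg i j) w → pos w < pos (leg i j) → w ≡ centre ⊎ Start w
  near-first {w = centre} _ _ _ = inj₁ refl
  near-first {i} {j} {leg _ j'} j≡0 (inj₁ (refl , _)) w<x =
    ⊥-elim (n≮0 (subst (toℕ j' <_) j≡0 (+-cancelˡ-< (offset l i) (toℕ j') (toℕ j) (≤-pred w<x))))
  near-first {w = leg _ _} j≡0 (inj₂ (_ , j'≡0)) _ = inj₂ (cong suc j'≡0)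

  prefix : ℕ → List V
  prefix p = take p vertices

  backDegree : ℕ → V → ℕ
  backDegree p x = count (near? x) (prefix p)

  starts : ℕ → ℕ
  starts p = count start? (prefix p)

  prefix-consecutive : ∀ p → Consecutive 0 (prefix p)
  prefix-consecutive p = consecutive-take p vertices-consecutive

  prefix-below : ∀ p {w} → w ∈ prefix p → pos w < p
  prefix-below p w∈ = ≤-trans (proj₂ (consecutive-range (prefix-consecutive p) w∈)) (length-take-≤ p vertices)

  count-window : ∀ p r → count (λ w → r ≤? pos w) (prefix p) ≤ p ∸ r
  count-window p r = ≤-trans (window-count r (prefix-consecutive p)) (∸-monoˡ-≤ r (length-take-≤ p vertices))

  count-centre : ∀ p → count (λ w → pos w ≤? 0) (prefix p) ≤ 1
  count-centre p = consecutive-first (prefix-consecutive p)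

  depth≤pos : ∀ x → depth x ≤ pos x
  depth≤pos centre    = z≤n
  depth≤pos (leg i j) = s≤s (m≤n+m (toℕ j) (offset l i))

  backDegree-deep : ∀ p {i j} → 2 ≤ toℕ j → backDegree p (leg i j) ≤ p ∸ (pos (leg i j) ∸ 2)
  backDegree-deep p {i} {j} 2≤j = ≤-trans (count-mono (near? (leg i j)) (λ w → pos (leg i j) ∸ 2 ≤? pos w) in-window)
                                         (count-window p _)
    where
    in-window : ∀ {w} → w ∈ prefix p → Near (leg i j) w → pos (leg i j) ∸ 2 ≤ pos w
    in-window _ near = m≤n+o⇒m∸n≤o _ 2 (≤-trans (near-deep 2≤j near) (≤-reflexive (+-comm _ 2)))

  backDegree-second : ∀ p {i j} → toℕ j ≡ 1 → backDegree p (leg i j) ≤ 1 + (p ∸ (pos (leg i j) ∸ 1))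
  backDegree-second p {i} {j} j≡1 =
    ≤-trans (count-∪ (near? (leg i j)) (λ w → pos w ≤? 0) (λ w → pos (leg i j) ∸ 1 ≤? pos w) centre-or-window)
            (+-mono-≤ (count-centre p) (count-window p _))
    where
    centre-or-window : ∀ {w} → w ∈ prefix p → Near (leg i j) w → pos w ≤ 0 ⊎ pos (leg i j) ∸ 1 ≤ pos w
    centre-or-window _ near with near-second j≡1 near
    ... | inj₁ refl = inj₁ z≤n
    ... | inj₂ x≤w+1 = inj₂ (m≤n+o⇒m∸n≤o _ 1 (≤-trans x≤w+1 (≤-reflexive (+-comm _ 1))))

  backDegree-first : ∀ p {i j} → toℕ j ≡ 0 → p ≤ pos (leg i j) → backDegree p (leg i j) ≤ 1 + starts p
  backDegree-first p {i} {j} j≡0 p≤x =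
    ≤-trans (count-∪ (near? (leg i j)) (λ w → pos w ≤? 0) start? centre-or-start) (+-monoˡ-≤ _ (count-centre p))
    where
    centre-or-start : ∀ {w} → w ∈ prefix p → Near (leg i j) w → pos w ≤ 0 ⊎ Start w
    centre-or-start w∈ near with near-first j≡0 near (≤-trans (prefix-below p w∈) p≤x)
    ... | inj₁ refl = inj₁ z≤n
    ... | inj₂ start = inj₂ start

  depth-cases : ∀ n → n ≡ 0 ⊎ n ≡ 1 ⊎ 2 ≤ n
  depth-cases 0             = inj₁ refl
  depth-cases 1             = inj₂ (inj₁ refl)
  depth-cases (suc (suc n)) = inj₂ (inj₂ (s≤s (s≤s z≤n)))

  -- How a vertex at a position ≥ p ≥ 1 is attached to the first p vertices: it is the first
  -- vertex of a leg, or it has at most 2 earlier Near-neighbours, and 2 only at position p.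
  ChunkBound : ℕ → V → Set
  ChunkBound p x = (Start x × backDegree p x ≤ 1 + starts p) ⊎
                   (backDegree p x ≤ 2 × (2 ≤ backDegree p x → pos x ≤ p))

  chunk-bound : ∀ p x → 1 ≤ p → p ≤ pos x → ChunkBound p x
  chunk-bound p centre    1≤p p≤0 = contradiction (≤-trans 1≤p p≤0) λ ()
  chunk-bound p (leg i j) 1≤p p≤x with depth-cases (toℕ j)
  ... | inj₁ j≡0 = inj₁ (cong suc j≡0 , backDegree-first p j≡0 p≤x)
  ... | inj₂ (inj₁ j≡1) =
        inj₂ (≤-trans second (s≤s (window-≤ 1≤x p≤x)) , λ 2≤d → window-full ≤-refl 1≤x (≤-pred (≤-trans 2≤d second)))
    where
    second : backDegree p (leg i j) ≤ 1 + (p ∸ (pos (leg i j) ∸ 1))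
    second = backDegree-second p j≡1
    1≤x : 1 ≤ pos (leg i j)
    1≤x = s≤s z≤n
  ... | inj₂ (inj₂ 2≤j) =
        inj₂ (≤-trans deep (window-≤ 2≤x p≤x) , λ 2≤d → window-full (s≤s z≤n) 2≤x (≤-trans 2≤d deep))
    where
    deep : backDegree p (leg i j) ≤ p ∸ (pos (leg i j) ∸ 2)
    deep = backDegree-deep p 2≤j
    2≤x : 2 ≤ pos (leg i j)
    2≤x = ≤-trans (s≤s (≤-trans (s≤s z≤n) 2≤j)) (depth≤pos (leg i j))

  deep-isolated : ∀ p {i j} → 2 ≤ toℕ j → p + 2 ≤ pos (leg i j) → backDegree p (leg i j) ≡ 0
  deep-isolated p 2≤j p+2≤x = n≤0⇒n≡0 (≤-trans (backDegree-deep p 2≤j) (≤-reflexive (window-empty {2} {p} p+2≤x)))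

  starts-total : count start? vertices ≤ m
  starts-total = subst (λ vs → count start? vs ≤ m) (cong concat (sym (map-tabulate id row)))
                   (count-concat start? row one-per-row)
    where
    one-per-row : ∀ i → count start? (row i) ≤ 1
    one-per-row i = count-at-most-one start? (Unique.map⁺ (λ { refl → refl }) (Unique.allFin⁺ (l i))) same-start
      where
      same-start : ∀ {x y} → x ∈ row i → y ∈ row i → Start x → Start y → x ≡ y
      same-start x∈ y∈ sx sy with ∈-map⁻ (leg i) x∈ | ∈-map⁻ (leg i) y∈
      ... | j , _ , refl | j' , _ , refl = cong (leg i) (FinP.toℕ-injective (suc-injective (trans sx (sym sy))))

  starts-split : ∀ p n → starts p + count start? (take n (drop p vertices)) ≤ m
  starts-split p n = begin
    starts p + count start? (take n (drop p vertices))              ≡⟨ sym (count-++ start? (prefix p) _) ⟩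
    count start? (take p vertices ++ take n (drop p vertices))      ≡⟨ cong (count start?) (sym (take-+ p n vertices)) ⟩
    count start? (take (p + n) vertices)                            ≤⟨ count-take start? (p + n) vertices ⟩
    count start? vertices                                           ≤⟨ starts-total ⟩
    m                                                               ∎
    where
    open ≤-Reasoning

  third-vertex : ∀ {i j} → 3 ≤ l i → toℕ j ≤ 1 →
                 ∃[ j₂ ] 2 ≤ toℕ j₂ × pos (leg i j) ≤ pos (leg i j₂) × pos (leg i j₂) ≤ pos (leg i j) + 2
  third-vertex {i} {j} 3≤li j≤1 = j₂ , ≤-reflexive (sym j₂≡2) , y≤z , z≤y+2
    where
    j₂ : Fin (l i)
    j₂ = fromℕ< 3≤li
    j₂≡2 : toℕ j₂ ≡ 2
    j₂≡2 = FinP.toℕ-fromℕ< 3≤li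
    y≤z : pos (leg i j) ≤ pos (leg i j₂)
    y≤z = s≤s (+-monoʳ-≤ (offset l i) (≤-trans j≤1 (≤-trans (n≤1+n 1) (≤-reflexive (sym j₂≡2)))))
    z≤y+2 : pos (leg i j₂) ≤ pos (leg i j) + 2
    z≤y+2 = s≤s (begin
      offset l i + toℕ j₂         ≡⟨ cong (offset l i +_) j₂≡2 ⟩
      offset l i + 2              ≤⟨ +-monoʳ-≤ (offset l i) (m≤n+m 2 (toℕ j)) ⟩
      offset l i + (toℕ j + 2)    ≡⟨ sym (+-assoc (offset l i) (toℕ j) 2) ⟩
      offset l i + toℕ j + 2      ∎)
      where open ≤-Reasoning

  offset-bound : ∀ {n} (ls : Fin n → ℕ) (i : Fin n) B → (∀ i' → toℕ i' < toℕ i → ls i' ≤ B) → offset ls i ≤ toℕ i * B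
  offset-bound ls fzero    B short = z≤n
  offset-bound ls (fsuc i) B short =
    +-mono-≤ (short fzero (s≤s z≤n)) (offset-bound (ls ∘ fsuc) i B (λ i' i'<i → short (fsuc i') (s≤s i'<i)))

  short-leg-early : NonDecreasing l → ∀ {i j} → l i ≤ 2 → pos (leg i j) ≤ toℕ i * 2 + 2
  short-leg-early mono {i} {j} li≤2 = begin
    suc (offset l i + toℕ j)   ≤⟨ s≤s (+-mono-≤ (offset-bound l i 2 earlier-short) j≤1) ⟩
    suc (toℕ i * 2 + 1)        ≡⟨ sym (+-suc (toℕ i * 2) 1) ⟩
    toℕ i * 2 + 2              ∎
    where
    open ≤-Reasoning
    earlier-short : ∀ i' → toℕ i' < toℕ i → l i' ≤ 2
    earlier-short i' i'<i = ≤-trans (mono i' i (<⇒≤ i'<i)) li≤2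
    j≤1 : toℕ j ≤ 1
    j≤1 = ≤-pred (≤-trans (FinP.toℕ<n j) li≤2)

  module Chunks (3≤m : 3 ≤ m) (mono : NonDecreasing l) where

    K : ℕ
    K = suc (suc m)

    chunk : ℕ → List V
    chunk p = take K (drop p vertices)

    chunk-consecutive : ∀ p → Consecutive p (chunk p)
    chunk-consecutive p = consecutive-take K (subst (λ s → Consecutive s (drop p vertices)) (+-identityʳ p)
                                                (consecutive-drop p vertices-consecutive))

    in-full-chunk : ∀ {p w} → length (chunk p) ≡ K → p ≤ pos w → pos w < p + K → w ∈ chunk p
    in-full-chunk {p} {w} full p≤w w<end
      with consecutive-at (chunk-consecutive p) (pos w) p≤w (subst (λ n → pos w < p + n) (sym full) w<end)
    ... | y , y∈ , y≡w = subst (_∈ chunk p) (consecutive-injective vertices-consecutive (all-vertices y) (all-vertices w) y≡w) y∈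

    m₁ : ℕ
    m₁ = pred m

    m≡ : suc m₁ ≡ m
    m≡ = suc-pred m {{>-nonZero (≤-trans (s≤s z≤n) 3≤m)}}

    2≤m₁ : 2 ≤ m₁
    2≤m₁ = pred-mono-≤ 3≤m

    -- the vertex y at position p + m − 1 and the third vertex of its leg lie in the chunk at p
    y-in-chunk : ∀ p → p + m₁ < p + K
    y-in-chunk p = +-monoʳ-< p (s≤s (≤-trans pred[n]≤n (n≤1+n m)))

    third-in-chunk : ∀ p → p + m₁ + 2 < p + K
    third-in-chunk p = begin-strict
      p + m₁ + 2      ≡⟨ +-assoc p m₁ 2 ⟩
      p + (m₁ + 2)    <⟨ +-monoʳ-< p (s≤s (≤-reflexive (trans (+-comm m₁ 2) (cong suc m≡)))) ⟩
      p + K           ∎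
      where open ≤-Reasoning

    beyond-short-legs : ∀ {p} → K ≤ p → m₁ * 2 + 2 < p + m₁
    beyond-short-legs {p} K≤p = begin-strict
      m₁ * 2 + 2           <⟨ n<1+n _ ⟩
      suc (m₁ * 2 + 2)     ≡⟨ sym (arithmetic m₁) ⟩
      suc (suc (suc m₁)) + m₁ ≡⟨ cong (λ n → suc (suc n) + m₁) m≡ ⟩
      K + m₁               ≤⟨ +-monoˡ-≤ m₁ K≤p ⟩
      p + m₁               ∎
      where
      open ≤-Reasoning
      arithmetic : ∀ n → suc (suc (suc n)) + n ≡ suc (n * 2 + 2)
      arithmetic = solve-∀

    -- A full chunk after the first contains a vertex without Near-neighbours before it: the
    -- vertex y at position p + m − 1 if it is deep, or else the third vertex of its leg,
    -- which exists because y lies beyond all legs of length ≤ 2.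
    isolated-vertex : ∀ {p} → K ≤ p → length (chunk p) ≡ K → ∃[ z ] z ∈ chunk p × backDegree p z ≡ 0
    isolated-vertex {p} K≤p full
      with consecutive-at (chunk-consecutive p) (p + m₁) (m≤m+n p m₁) (subst (λ n → p + m₁ < p + n) (sym full) (y-in-chunk p))
    ... | centre , _ , 0≡P = contradiction (≤-trans (≤-trans (s≤s z≤n) K≤p) (≤-trans (m≤m+n p m₁) (≤-reflexive (sym 0≡P)))) λ ()
    ... | leg i j , y∈ , y≡P with 2 ≤? toℕ j | 3 ≤? l i
    ...   | yes 2≤j | _ = leg i j , y∈ , deep-isolated p 2≤j (subst (p + 2 ≤_) (sym y≡P) (+-monoʳ-≤ p 2≤m₁))
    ...   | no j≱2 | no li≱3 = contradiction (short-leg-early mono (≤-pred (≰⇒> li≱3))) (<⇒≱ late)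
      where
      i≤m₁ : toℕ i ≤ m₁
      i≤m₁ = ≤-pred (subst (toℕ i <_) (sym m≡) (FinP.toℕ<n i))
      late : toℕ i * 2 + 2 < pos (leg i j)
      late = ≤-trans (s≤s (+-monoˡ-≤ 2 (*-monoˡ-≤ 2 i≤m₁))) (≤-trans (beyond-short-legs K≤p) (≤-reflexive (sym y≡P)))
    ...   | no j≱2 | yes 3≤li with third-vertex 3≤li (≤-pred (≰⇒> j≱2))
    ...     | j₂ , 2≤j₂ , y≤z , z≤y+2 =
              leg i j₂ , in-full-chunk full (≤-trans (m≤m+n p 2) p+2≤z) z<end , deep-isolated p 2≤j₂ p+2≤z
      where
      p+2≤z : p + 2 ≤ pos (leg i j₂)
      p+2≤z = ≤-trans (+-monoʳ-≤ p 2≤m₁) (≤-trans (≤-reflexive (sym y≡P)) y≤z)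
      z<end : pos (leg i j₂) < p + K
      z<end = ≤-trans (s≤s (≤-trans z≤y+2 (≤-reflexive (cong (_+ 2) y≡P)))) (third-in-chunk p)

    chunk-vertex : ∀ {p x} → 1 ≤ p → x ∈ chunk p → ChunkBound p x
    chunk-vertex {p} 1≤p x∈ = chunk-bound p _ 1≤p (proj₁ (consecutive-range (chunk-consecutive p) x∈))

    -- (t = 1) a full chunk contains a vertex without earlier Near-neighbours
    condition-1 : ∀ {p} → K ≤ p → count (λ x → 1 ≤? backDegree p x) (chunk p) + 1 ≤ K
    condition-1 {p} K≤p = ≤-trans (≤-reflexive (+-comm _ 1)) below-length
      where
      below-length : suc (count (λ x → 1 ≤? backDegree p x) (chunk p)) ≤ K
      below-length with length (chunk p) ≟ K
      ... | yes full with isolated-vertex K≤p full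
      ...   | z , z∈ , d≡0 = subst (suc (count (λ x → 1 ≤? backDegree p x) (chunk p)) ≤_) full
                               (count-missing (λ x → 1 ≤? backDegree p x) z∈ (λ 1≤d → contradiction (subst (1 ≤_) d≡0 1≤d) λ ()))
      below-length | no not-full =
        ≤-trans (s≤s (count-≤-length _ (chunk p))) (≤∧≢⇒< (length-take-≤ K (drop p vertices)) not-full)

    -- (t = 2) apart from the vertex at position p, only first leg vertices can have two earlier
    -- Near-neighbours, and only if the prefix contains a first leg vertex
    condition-2 : ∀ {p} → K ≤ p → count (λ x → 2 ≤? backDegree p x) (chunk p) + 2 ≤ K
    condition-2 {p} K≤p with starts p ≟ 0
    ... | yes a≡0 = ≤-trans (+-monoˡ-≤ 2 (≤-trans (count-mono _ _ at-start) (≤-trans (consecutive-first (chunk-consecutive p)) 1≤m)))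
                            (≤-reflexive (+-comm m 2))
      where
      1≤m : 1 ≤ m
      1≤m = ≤-trans (s≤s z≤n) 3≤m
      at-start : ∀ {x} → x ∈ chunk p → 2 ≤ backDegree p x → pos x ≤ p
      at-start {x} x∈ 2≤d with chunk-vertex (≤-trans (s≤s z≤n) K≤p) x∈
      ... | inj₁ (_ , d≤1+a) = contradiction (≤-trans 2≤d (subst (λ a → backDegree p x ≤ 1 + a) a≡0 d≤1+a)) λ { (s≤s ()) }
      ... | inj₂ (_ , d≥2⇒x≤p) = d≥2⇒x≤p 2≤d
    ... | no a≢0 = ≤-trans (+-monoˡ-≤ 2 (begin
        count (λ x → 2 ≤? backDegree p x) (chunk p)                     ≤⟨ count-∪ _ start? _ start-or-first ⟩
        count start? (chunk p) + count (λ x → pos x ≤? p) (chunk p)     ≤⟨ +-monoʳ-≤ _ (consecutive-first (chunk-consecutive p)) ⟩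
        count start? (chunk p) + 1                                      ≤⟨ +-monoʳ-≤ _ (n≢0⇒n>0 a≢0) ⟩
        count start? (chunk p) + starts p                               ≡⟨ +-comm _ (starts p) ⟩
        starts p + count start? (chunk p)                               ≤⟨ starts-split p K ⟩
        m                                                               ∎)) (≤-reflexive (+-comm m 2))
      where
      open ≤-Reasoning
      start-or-first : ∀ {x} → x ∈ chunk p → 2 ≤ backDegree p x → Start x ⊎ pos x ≤ p
      start-or-first x∈ 2≤d with chunk-vertex (≤-trans (s≤s z≤n) K≤p) x∈
      ... | inj₁ (start , _) = inj₁ start
      ... | inj₂ (_ , d≥2⇒x≤p) = inj₂ (d≥2⇒x≤p 2≤d)

    -- (t ≥ 3) only first leg vertices can have t earlier Near-neighbours, and only if the
    -- prefix contains t − 1 first leg vertices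
    condition-3 : ∀ {p} t → K ≤ p → 3 ≤ t → t ≤ K → count (λ x → t ≤? backDegree p x) (chunk p) + t ≤ K
    condition-3 {p} t K≤p 3≤t t≤K with t ≤? 1 + starts p
    ... | no t≰1+a = subst (λ c → c + t ≤ K) (sym (count-none _ impossible)) t≤K
      where
      impossible : ∀ {x} → x ∈ chunk p → ¬ (t ≤ backDegree p x)
      impossible x∈ t≤d with chunk-vertex (≤-trans (s≤s z≤n) K≤p) x∈
      ... | inj₁ (_ , d≤1+a) = t≰1+a (≤-trans t≤d d≤1+a)
      ... | inj₂ (d≤2 , _) = contradiction (≤-trans 3≤t (≤-trans t≤d d≤2)) λ { (s≤s (s≤s ())) }
    ... | yes t≤1+a = begin
        count (λ x → t ≤? backDegree p x) (chunk p) + t   ≤⟨ +-mono-≤ (count-mono _ start? only-starts) t≤1+a ⟩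
        count start? (chunk p) + (1 + starts p)          ≡⟨ trans (+-suc _ (starts p)) (cong suc (+-comm _ (starts p))) ⟩
        suc (starts p + count start? (chunk p))          ≤⟨ s≤s (starts-split p K) ⟩
        suc m                                            ≤⟨ n≤1+n _ ⟩
        K                                                ∎
      where
      open ≤-Reasoning
      only-starts : ∀ {x} → x ∈ chunk p → t ≤ backDegree p x → Start x
      only-starts x∈ t≤d with chunk-vertex (≤-trans (s≤s z≤n) K≤p) x∈
      ... | inj₁ (start , _) = start
      ... | inj₂ (d≤2 , _) = contradiction (≤-trans 3≤t (≤-trans t≤d d≤2)) λ { (s≤s (s≤s ())) }

    open ChunkedGreedy _≟V_ Adj² near? adj²⇒near adj²-sym adj²-irrefl (suc m) using (ChunkCondition; equitably-choosable)

    -- every chunk satisfies the chunk condition; the first trivially, its prefix being empty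
    chunk-condition : ∀ q → ChunkCondition (prefix (q * K)) (chunk (q * K))
    chunk-condition zero t 1≤t t≤K =
      subst (λ c → c + t ≤ K) (sym (count-none (λ x → t ≤? backDegree 0 x) {chunk 0} (λ _ t≤0 → contradiction (≤-trans 1≤t t≤0) λ ())))
            t≤K
    chunk-condition (suc q) 1 _ _ = condition-1 (m≤m+n K (q * K))
    chunk-condition (suc q) 2 _ _ = condition-2 (m≤m+n K (q * K))
    chunk-condition (suc q) t@(suc (suc (suc _))) _ t≤K = condition-3 t (m≤m+n K (q * K)) (s≤s (s≤s (s≤s z≤n))) t≤K

    spider-equitable : EquitablyChoosable vertices Adj² K
    spider-equitable = equitably-choosable vertices (consecutive-unique vertices-consecutive) all-vertices chunk-condition

lemma2p4 : (m : ℕ) → 3 ≤ m → (l : Fin m → ℕ) → NonDecreasing l →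
    EquitablyChoosable (bVertices m l) (Square BAdj) (m + 2)
lemma2p4 m 3≤m l mono =
  subst (EquitablyChoosable (bVertices m l) (Square BAdj)) (+-comm 2 m) (Spider.Chunks.spider-equitable m l 3≤m mono)
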